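{- For every augmented program $P$ there exists a computable disjunctive program $P'$ such that the sets $M'\cap\sigma_P$, where $M'$ ranges over the min-answer sets of $P'$, are exactly the answer sets of $P$.
   Context: $\sigma_P$ is the set of atoms occurring in $P$. A nested formula is built from atoms, $\bot,\top$ using $\land,\lor,\neg$; an augmented program is a finite set of clauses $H\leftarrow B$ ($B$ implies $H$) with $H,B$ nested formulas. A disjunctive program is a finite set of clauses $h_1\lor\dots\lor h_n\leftarrow b_1\land\dots\land b_m$ with $n\ge1$, each $h_i$ an atom and each $b_j$ an atom or negated atom. Answer sets: basic formulas are built from atoms, $\bot,\top$ with $\land,\lor$. For a set of atoms $X$: $X\models a$ iff $a\in X$, $X\models\top$, $X\not\models\bot$, $X\models F\land G$ iff both, $X\models F\lor G$ iff either. $X$ is closed under a basic program $Q$ if for each $H\leftarrow B\in Q$, $X\models B$ implies $X\models H$; $X$ is an answer set of basic $Q$ if $\subseteq$-minimal among sets closed under $Q$. Reduct: $F^X=F$ for atoms, $\bot,\top$; $(F\land G)^X=F^X\land G^X$; $(F\lor G)^X=F^X\lor G^X$; $(\neg F)^X=\bot$ if $X\models F^X$, else $\top$; $(H\leftarrow B)^X=H^X\leftarrow B^X$; $P^X=\{C^X:C\in P\}$. $X$ is an answer set of augmented $P$ iff $X$ is an answer set of $P^X$. A set of atoms $M$ is a model of a program if the classical interpretation making exactly the atoms of $M$ true satisfies all its clauses; a minimal model if no proper subset is a model. A min-answer set is a set that is both an answer set and a minimal model. -}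

module Defs where

open import Data.Nat using (ℕ; _≡ᵇ_)
open import Data.Bool using (Bool; true; false; _∧_; _∨_; not; if_then_else_)
open import Data.List using (List; []; _∷_; _++_)
open import Data.Bool.ListAction using (any)
open import Data.Product using (Σ; _×_; _,_)
open import Relation.Binary.PropositionalEquality using (_≡_)

-- Atoms are natural numbers (an infinite supply, so fresh atoms exist).
Atom : Set
Atom = ℕ

AtomSet : Set
AtomSet = Atom → Bool

_⊆_ : AtomSet → AtomSet → Set
X ⊆ Y = ∀ a → X a ≡ true → Y a ≡ true

_≐_ : AtomSet → AtomSet → Set
X ≐ Y = ∀ a → X a ≡ Y a

data Nested : Set where
  atom : Atom → Nested
  ⊥ₙ ⊤ₙ : Nested
  _∧ₙ_ _∨ₙ_ : Nested → Nested → Nested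
  ¬ₙ_ : Nested → Nested

record Clause : Set where
  constructor _⇐_
  field
    head : Nested
    body : Nested

AugProgram : Set
AugProgram = List Clause

atomsF : Nested → List Atom
atomsF (atom a) = a ∷ []
atomsF ⊥ₙ = []
atomsF ⊤ₙ = []
atomsF (F ∧ₙ G) = atomsF F ++ atomsF G
atomsF (F ∨ₙ G) = atomsF F ++ atomsF G
atomsF (¬ₙ F) = atomsF F

σ : AugProgram → List Atom
σ [] = []
σ ((H ⇐ B) ∷ P) = atomsF H ++ atomsF B ++ σ P

inσ : AugProgram → Atom → Bool
inσ P a = any (λ b → a ≡ᵇ b) (σ P)

data Basic : Set where
  atom : Atom → Basic
  ⊥ᵦ ⊤ᵦ : Basic
  _∧ᵦ_ _∨ᵦ_ : Basic → Basic → Basic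

_⊨_ : AtomSet → Basic → Bool
X ⊨ atom a = X a
X ⊨ ⊥ᵦ = false
X ⊨ ⊤ᵦ = true
X ⊨ (F ∧ᵦ G) = (X ⊨ F) ∧ (X ⊨ G)
X ⊨ (F ∨ᵦ G) = (X ⊨ F) ∨ (X ⊨ G)

record BasicClause : Set where
  constructor _⇐ᵦ_
  field
    head : Basic
    body : Basic

BasicProgram : Set
BasicProgram = List BasicClause

data ClosedUnder (X : AtomSet) : BasicProgram → Set where
  []  : ClosedUnder X []
  _∷_ : ∀ {H B Q} → (X ⊨ B ≡ true → X ⊨ H ≡ true) →
        ClosedUnder X Q → ClosedUnder X ((H ⇐ᵦ B) ∷ Q)

BasicAnswerSet : BasicProgram → AtomSet → Set
BasicAnswerSet Q X =
  ClosedUnder X Q × (∀ Y → ClosedUnder Y Q → Y ⊆ X → X ⊆ Y)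

reductF : AtomSet → Nested → Basic
reductF X (atom a) = atom a
reductF X ⊥ₙ = ⊥ᵦ
reductF X ⊤ₙ = ⊤ᵦ
reductF X (F ∧ₙ G) = reductF X F ∧ᵦ reductF X G
reductF X (F ∨ₙ G) = reductF X F ∨ᵦ reductF X G
reductF X (¬ₙ F) = if X ⊨ reductF X F then ⊥ᵦ else ⊤ᵦ

reduct : AugProgram → AtomSet → BasicProgram
reduct [] X = []
reduct ((H ⇐ B) ∷ P) X = (reductF X H ⇐ᵦ reductF X B) ∷ reduct P X

AnswerSet : AugProgram → AtomSet → Set
AnswerSet P X = BasicAnswerSet (reduct P X) X

evalN : AtomSet → Nested → Bool
evalN M (atom a) = M a
evalN M ⊥ₙ = false
evalN M ⊤ₙ = true
evalN M (F ∧ₙ G) = evalN M F ∧ evalN M G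
evalN M (F ∨ₙ G) = evalN M F ∨ evalN M G
evalN M (¬ₙ F) = not (evalN M F)

data Model (M : AtomSet) : AugProgram → Set where
  []  : Model M []
  _∷_ : ∀ {H B P} → (evalN M B ≡ true → evalN M H ≡ true) →
        Model M P → Model M ((H ⇐ B) ∷ P)

MinimalModel : AugProgram → AtomSet → Set
MinimalModel P M = Model M P × (∀ Y → Model Y P → Y ⊆ M → M ⊆ Y)

data Literal : Set where
  pos : Atom → Literal
  neg : Atom → Literal

-- h₁ ∨ … ∨ hₙ ← b₁ ∧ … ∧ bₘ,  n ≥ 1 (head = first atom h₁ and the rest)
record DisjClause : Set where
  constructor disj
  field
    head₁    : Atom
    headRest : List Atom
    body     : List Literal

DisjProgram : Set
DisjProgram = List DisjClause

litF : Literal → Nested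
litF (pos a) = atom a
litF (neg a) = ¬ₙ atom a

headF : Atom → List Atom → Nested
headF h [] = atom h
headF h (k ∷ ks) = atom h ∨ₙ headF k ks

bodyF : List Literal → Nested
bodyF [] = ⊤ₙ
bodyF (b ∷ []) = litF b
bodyF (b ∷ c ∷ bs) = litF b ∧ₙ bodyF (c ∷ bs)

toAug : DisjProgram → AugProgram
toAug [] = []
toAug (disj h hs bs ∷ P) = (headF h hs ⇐ bodyF bs) ∷ toAug P

MinAnswerSet : DisjProgram → AtomSet → Set
MinAnswerSet P M = AnswerSet (toAug P) M × MinimalModel (toAug P) M

_∩σ_ : AtomSet → AugProgram → AtomSet
(M ∩σ P) a = M a ∧ inσ P a

-- An answer set X of P lies inside σ_P: the reduct P^X mentions only atoms of P, so X ∩ σ_P is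
-- closed under it as well, and minimality applies. For a finite candidate both closedness and
-- minimality are decidable (minimality needs only the finitely many subsets of the candidate),
-- so the answer sets L₁, …, Lₖ of P can be listed. With fresh atoms c₁, …, cₖ, the program
--   c₁ ∨ … ∨ cₖ ←        a ← cᵢ  (a ∈ Lᵢ)
-- is negation-free, so its min-answer sets are its minimal models, namely the sets {cᵢ} ∪ Lᵢ;
-- intersecting with σ_P drops cᵢ. When k = 0 the program 0 ← not 0, which has no answer set,
-- is used instead.
module Submission where

open import Defs
open import Data.Bool using (true; false; _∧_; _∨_; if_then_else_)
open import Data.Bool.Properties using (∨-zeroʳ; ∧-conicalˡ; ∧-conicalʳ; ∧-identityʳ; ⇔→≡; T-≡)
  renaming (_≟_ to _≟ᵇ_)
open import Data.Bool.ListAction using (any)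
open import Data.Empty using (⊥-elim)
open import Data.List using (List; []; _∷_; _++_; map; concatMap; filter)
open import Data.List.Extrema.Nat using (max; xs≤max)
open import Data.List.Membership.Propositional using (_∈_; _∉_; find)
open import Data.List.Membership.Propositional.Properties
  using (∈-++⁺ˡ; ∈-++⁺ʳ; ∈-++⁻; ∈-map⁺; ∈-map⁻; ∈-filter⁺; ∈-filter⁻)
open import Data.List.Relation.Binary.Subset.Propositional as List using ()
open import Data.List.Relation.Unary.All as All using (All; []; _∷_; all?)
import Data.List.Relation.Unary.All.Properties as All
open import Data.List.Relation.Unary.Any as Any using (Any; here; there)
open import Data.List.Relation.Unary.Any.Properties using (any⁺; any⁻)
import Data.List.Relation.Unary.Any.Properties as Any
open import Data.Nat using (ℕ; suc; _≡ᵇ_; _≤_; _<_; s≤s)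
open import Data.Nat.Properties using (≡ᵇ⇒≡; ≡⇒≡ᵇ; ≤-refl; ≤-trans; n≤1+n; 1+n≰n; <⇒≱)
open import Data.Product using (Σ; ∃; ∃₂; _×_; _,_; proj₁; proj₂; uncurry; map₂)
open import Data.Sum using (inj₁; inj₂)
open import Function using (_∘_; _⇔_; mk⇔; Equivalence)
open import Relation.Nullary using (¬_; Dec; yes; does)
open import Relation.Unary using (Decidable)
open import Relation.Nullary.Decidable using (map′; _×-dec_; _→-dec_)
open import Relation.Binary.PropositionalEquality using (_≡_; refl; sym; trans; cong; cong₂)
open Relation.Binary.PropositionalEquality.≡-Reasoning

⊆-antisym : ∀ {X Y} → X ⊆ Y → Y ⊆ X → X ≐ Y
⊆-antisym X⊆Y Y⊆X a = ⇔→≡ (mk⇔ (X⊆Y a) (Y⊆X a))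

-- inσ P is fromList (σ P) by definition.
fromList : List Atom → AtomSet
fromList L a = any (a ≡ᵇ_) L

∈⇒fromList : ∀ {L a} → a ∈ L → fromList L a ≡ true
∈⇒fromList {L} {a} = Equivalence.to T-≡ ∘ any⁺ (a ≡ᵇ_) ∘ Any.map (≡⇒≡ᵇ a _)

fromList⇒∈ : ∀ L a → fromList L a ≡ true → a ∈ L
fromList⇒∈ L a = Any.map (≡ᵇ⇒≡ a _) ∘ any⁻ (a ≡ᵇ_) L ∘ Equivalence.from T-≡

subsets : {A : Set} → List A → List (List A)
subsets [] = [] ∷ []
subsets (x ∷ xs) = subsets xs ++ map (x ∷_) (subsets xs)

subsets-⊆ : {A : Set} {xs ys : List A} → ys ∈ subsets xs → ys List.⊆ xs
subsets-⊆ {xs = []} (here refl) ()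
subsets-⊆ {xs = x ∷ xs} p with ∈-++⁻ (subsets xs) p
... | inj₁ q = there ∘ subsets-⊆ q
... | inj₂ q with ∈-map⁻ (x ∷_) q
... | ys , q′ , refl = λ { (here refl) → here refl ; (there r) → there (subsets-⊆ q′ r) }

filter∈subsets : {A : Set} {P : A → Set} (P? : Decidable P) (xs : List A) →
                 filter P? xs ∈ subsets xs
filter∈subsets P? [] = here refl
filter∈subsets P? (x ∷ xs) with does (P? x)
... | true  = ∈-++⁺ʳ _ (∈-map⁺ (x ∷_) (filter∈subsets P? xs))
... | false = ∈-++⁺ˡ (filter∈subsets P? xs)

listWithin : List Atom → AtomSet → List Atom
listWithin L Y = filter (λ a → Y a ≟ᵇ true) L

listWithin∈subsets : ∀ L Y → listWithin L Y ∈ subsets L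
listWithin∈subsets L Y = filter∈subsets (λ a → Y a ≟ᵇ true) L

fromList-listWithin : ∀ {Y} L → Y ⊆ fromList L → fromList (listWithin L Y) ≐ Y
fromList-listWithin {Y} L Y⊆L = ⊆-antisym
  (λ a → proj₂ ∘ ∈-filter⁻ Y? {xs = L} ∘ fromList⇒∈ _ a)
  (λ a Ya → ∈⇒fromList (∈-filter⁺ Y? (fromList⇒∈ L a (Y⊆L a Ya)) Ya))
  where
  Y? = λ b → Y b ≟ᵇ true

⊨-cong : ∀ {X Y} → X ≐ Y → ∀ G → X ⊨ G ≡ Y ⊨ G
⊨-cong X≐Y (atom a) = X≐Y a
⊨-cong X≐Y ⊥ᵦ = refl
⊨-cong X≐Y ⊤ᵦ = refl
⊨-cong X≐Y (F ∧ᵦ G) = cong₂ _∧_ (⊨-cong X≐Y F) (⊨-cong X≐Y G)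
⊨-cong X≐Y (F ∨ᵦ G) = cong₂ _∨_ (⊨-cong X≐Y F) (⊨-cong X≐Y G)

closed-cong : ∀ {X Y Q} → X ≐ Y → ClosedUnder X Q → ClosedUnder Y Q
closed-cong X≐Y [] = []
closed-cong X≐Y (_∷_ {H} {B} closedHB closed) =
  (λ YB → trans (sym (⊨-cong X≐Y H)) (closedHB (trans (⊨-cong X≐Y B) YB))) ∷ closed-cong X≐Y closed

reductF-local : ∀ {X Y} Z F → (∀ {a} → a ∈ atomsF F → X a ≡ Y a) →
                X ⊨ reductF Z F ≡ Y ⊨ reductF Z F
reductF-local Z (atom a) agree = agree (here refl)
reductF-local Z ⊥ₙ agree = refl
reductF-local Z ⊤ₙ agree = refl
reductF-local Z (F ∧ₙ G) agree =
  cong₂ _∧_ (reductF-local Z F (agree ∘ ∈-++⁺ˡ)) (reductF-local Z G (agree ∘ ∈-++⁺ʳ (atomsF F)))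
reductF-local Z (F ∨ₙ G) agree =
  cong₂ _∨_ (reductF-local Z F (agree ∘ ∈-++⁺ˡ)) (reductF-local Z G (agree ∘ ∈-++⁺ʳ (atomsF F)))
reductF-local Z (¬ₙ F) agree with Z ⊨ reductF Z F
... | true  = refl
... | false = refl

closed-local : ∀ {X Y Z} P → (∀ {a} → a ∈ σ P → X a ≡ Y a) →
               ClosedUnder X (reduct P Z) → ClosedUnder Y (reduct P Z)
closed-local [] agree [] = []
closed-local {X} {Y} {Z} ((H ⇐ B) ∷ P) agree (closedHB ∷ closed) =
  (λ YB → trans (sym (reductF-local Z H agreeH)) (closedHB (trans (reductF-local Z B agreeB) YB)))
  ∷ closed-local P (λ a∈P → agree (∈-++⁺ʳ (atomsF H) (∈-++⁺ʳ (atomsF B) a∈P))) closed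
  where
  agreeH : ∀ {a} → a ∈ atomsF H → X a ≡ Y a
  agreeH a∈H = agree (∈-++⁺ˡ a∈H)
  agreeB : ∀ {a} → a ∈ atomsF B → X a ≡ Y a
  agreeB a∈B = agree (∈-++⁺ʳ (atomsF H) (∈-++⁺ˡ a∈B))

reductF-cong : ∀ {X Y} → X ≐ Y → ∀ F → reductF X F ≡ reductF Y F
reductF-cong X≐Y (atom a) = refl
reductF-cong X≐Y ⊥ₙ = refl
reductF-cong X≐Y ⊤ₙ = refl
reductF-cong X≐Y (F ∧ₙ G) = cong₂ _∧ᵦ_ (reductF-cong X≐Y F) (reductF-cong X≐Y G)
reductF-cong X≐Y (F ∨ₙ G) = cong₂ _∨ᵦ_ (reductF-cong X≐Y F) (reductF-cong X≐Y G)
reductF-cong {X} {Y} X≐Y (¬ₙ F) = cong (if_then ⊥ᵦ else ⊤ᵦ)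
  (trans (cong (X ⊨_) (reductF-cong X≐Y F)) (⊨-cong X≐Y (reductF Y F)))

reduct-cong : ∀ {X Y} → X ≐ Y → ∀ P → reduct P X ≡ reduct P Y
reduct-cong X≐Y [] = refl
reduct-cong X≐Y ((H ⇐ B) ∷ P) =
  cong₂ _∷_ (cong₂ _⇐ᵦ_ (reductF-cong X≐Y H) (reductF-cong X≐Y B)) (reduct-cong X≐Y P)

answerSet-cong : ∀ {X Y} P → X ≐ Y → AnswerSet P X → AnswerSet P Y
answerSet-cong {X} {Y} P X≐Y (closed , minimal) rewrite sym (reduct-cong X≐Y P) =
  closed-cong X≐Y closed ,
  λ Z closedZ Z⊆Y a Ya → minimal Z closedZ (λ b Zb → trans (X≐Y b) (Z⊆Y b Zb)) a (trans (X≐Y a) Ya)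

answerSet⊆σ : ∀ {X} P → AnswerSet P X → X ⊆ inσ P
answerSet⊆σ {X} P (closed , minimal) a Xa =
  ∧-conicalʳ (X a) _ (minimal (X ∩σ P) (closed-local P X≐X∩σ closed) (λ b → ∧-conicalˡ _ _) a Xa)
  where
  X≐X∩σ : ∀ {b} → b ∈ σ P → X b ≡ (X ∩σ P) b
  X≐X∩σ {b} b∈σ = sym (trans (cong (X b ∧_) (∈⇒fromList b∈σ)) (∧-identityʳ (X b)))

Minimal : BasicProgram → AtomSet → Set
Minimal Q X = ∀ Y → ClosedUnder Y Q → Y ⊆ X → X ⊆ Y

closed? : ∀ X Q → Dec (ClosedUnder X Q)
closed? X [] = yes []
closed? X ((H ⇐ᵦ B) ∷ Q) =
  map′ (uncurry _∷_) (λ { (closedHB ∷ closed) → closedHB , closed })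
       ((X ⊨ B ≟ᵇ true →-dec X ⊨ H ≟ᵇ true) ×-dec closed? X Q)

minimal⇔ : ∀ Q L → Minimal Q (fromList L) ⇔
           All (λ L′ → ClosedUnder (fromList L′) Q → All (λ a → fromList L′ a ≡ true) L) (subsets L)
minimal⇔ Q L = mk⇔
  (λ minimal → All.tabulate λ {L′} L′∈ closed → All.tabulate λ {a} a∈L →
     let L′⊆L = λ b → ∈⇒fromList ∘ subsets-⊆ {xs = L} L′∈ ∘ fromList⇒∈ L′ b
     in minimal (fromList L′) closed L′⊆L a (∈⇒fromList a∈L))
  (λ checks Y closedY Y⊆L a La →
     let Y≐ = fromList-listWithin L Y⊆L
         check = All.lookup checks (listWithin∈subsets L Y) (closed-cong (sym ∘ Y≐) closedY)
     in trans (sym (Y≐ a)) (All.lookup check (fromList⇒∈ L a La)))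

answerSet? : ∀ P L → Dec (AnswerSet P (fromList L))
answerSet? P L = map′ (map₂ from) (map₂ to) (closed? (fromList L) Q ×-dec all? check (subsets L))
  where
  Q = reduct P (fromList L)
  open Equivalence (minimal⇔ Q L)
  check = λ L′ → closed? (fromList L′) Q →-dec all? (λ a → fromList L′ a ≟ᵇ true) L

data NegationFree : Nested → Set where
  atom : ∀ a → NegationFree (atom a)
  ⊥ₙ   : NegationFree ⊥ₙ
  ⊤ₙ   : NegationFree ⊤ₙ
  _∧ₙ_ : ∀ {F G} → NegationFree F → NegationFree G → NegationFree (F ∧ₙ G)
  _∨ₙ_ : ∀ {F G} → NegationFree F → NegationFree G → NegationFree (F ∨ₙ G)

⊨-reductF : ∀ {X Y F} → NegationFree F → Y ⊨ reductF X F ≡ evalN Y F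
⊨-reductF (atom a) = refl
⊨-reductF ⊥ₙ = refl
⊨-reductF ⊤ₙ = refl
⊨-reductF (F ∧ₙ G) = cong₂ _∧_ (⊨-reductF F) (⊨-reductF G)
⊨-reductF (F ∨ₙ G) = cong₂ _∨_ (⊨-reductF F) (⊨-reductF G)

Positive : AugProgram → Set
Positive = All λ C → NegationFree (Clause.head C) × NegationFree (Clause.body C)

closed⇒model : ∀ {X Y P} → Positive P → ClosedUnder Y (reduct P X) → Model Y P
closed⇒model [] [] = []
closed⇒model ((nfH , nfB) ∷ positive) (closedHB ∷ closed) =
  (λ YB → trans (sym (⊨-reductF nfH)) (closedHB (trans (⊨-reductF nfB) YB)))
  ∷ closed⇒model positive closed

model⇒closed : ∀ {X Y P} → Positive P → Model Y P → ClosedUnder Y (reduct P X)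
model⇒closed [] [] = []
model⇒closed ((nfH , nfB) ∷ positive) (modelHB ∷ model) =
  (λ YB → trans (⊨-reductF nfH) (modelHB (trans (sym (⊨-reductF nfB)) YB)))
  ∷ model⇒closed positive model

minimalModel⇒answerSet : ∀ {P M} → Positive P → MinimalModel P M → AnswerSet P M
minimalModel⇒answerSet positive (model , minimal) =
  model⇒closed positive model , λ Y → minimal Y ∘ closed⇒model positive

toClause : DisjClause → Clause
toClause (disj h hs bs) = headF h hs ⇐ bodyF bs

all-toAug⇔ : ∀ {R : Clause → Set} D → All R (toAug D) ⇔ All (R ∘ toClause) D
all-toAug⇔ [] = mk⇔ (λ _ → []) (λ _ → [])
all-toAug⇔ (disj _ _ _ ∷ D) = mk⇔ (λ { (r ∷ rs) → r ∷ to rs }) (λ { (r ∷ rs) → r ∷ from rs })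
  where open Equivalence (all-toAug⇔ D)

Satisfies : AtomSet → Clause → Set
Satisfies M (H ⇐ B) = evalN M B ≡ true → evalN M H ≡ true

model⇔all : ∀ {M} P → Model M P ⇔ All (Satisfies M) P
model⇔all [] = mk⇔ (λ _ → []) (λ _ → [])
model⇔all (_ ∷ P) = mk⇔ (λ { (s ∷ m) → s ∷ to m }) (λ { (s ∷ ss) → s ∷ from ss })
  where open Equivalence (model⇔all P)

headF-negationFree : ∀ h hs → NegationFree (headF h hs)
headF-negationFree h [] = atom h
headF-negationFree h (k ∷ ks) = atom h ∨ₙ headF-negationFree k ks

headF-true⁻ : ∀ M h hs → evalN M (headF h hs) ≡ true → Any (λ a → M a ≡ true) (h ∷ hs)
headF-true⁻ M h [] Mh = here Mh
headF-true⁻ M h (k ∷ ks) holds with M h in Mh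
... | true  = here Mh
... | false = there (headF-true⁻ M k ks holds)

headF-true⁺ : ∀ M h hs → Any (λ a → M a ≡ true) (h ∷ hs) → evalN M (headF h hs) ≡ true
headF-true⁺ M h [] (here Mh) = Mh
headF-true⁺ M h (k ∷ ks) (here Mh) rewrite Mh = refl
headF-true⁺ M h (k ∷ ks) (there any) rewrite headF-true⁺ M k ks any = ∨-zeroʳ (M h)

implications : List (Atom × List Atom) → DisjProgram
implications = concatMap λ (c , L) → map (λ a → disj a [] (pos c ∷ [])) L

all-implications⇔ : ∀ {R : Clause → Set} T → All R (toAug (implications T)) ⇔
                    (∀ {c L a} → (c , L) ∈ T → a ∈ L → R (atom a ⇐ atom c))
all-implications⇔ T = mk⇔
  (λ all {c} {L} {a} c∈ →
     All.lookup (All.map⁻ (All.lookup (All.map⁻ (All.concat⁻ (to all))) c∈)))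
  (λ r → from (All.concat⁺ (All.map⁺ (All.tabulate λ c∈ → All.map⁺ (All.tabulate (r c∈))))))
  where open Equivalence (all-toAug⇔ (implications T))

selection : List (Atom × List Atom) → DisjProgram
selection [] = disj 0 [] (neg 0 ∷ []) ∷ []
selection ((c , L) ∷ T) = disj c (map proj₁ T) [] ∷ implications ((c , L) ∷ T)

selection[]-noAnswerSet : ∀ {M} → ¬ AnswerSet (toAug (selection [])) M
selection[]-noAnswerSet {M} ((closed0 ∷ []) , minimal) with M 0 in M0
... | false with () ← closed0 refl
... | true  with () ← minimal (λ _ → false) ((λ ()) ∷ []) (λ _ ()) 0 M0

selection-positive : ∀ t T → Positive (toAug (selection (t ∷ T)))
selection-positive (c , L) T =
  (headF-negationFree c (map proj₁ T) , ⊤ₙ) ∷ from (λ _ _ → atom _ , atom _)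
  where open Equivalence (all-implications⇔ ((c , L) ∷ T))

Selects : AtomSet → List (Atom × List Atom) → Set
Selects M T = Any (λ t → M (proj₁ t) ≡ true) T

Propagates : AtomSet → List (Atom × List Atom) → Set
Propagates M T = ∀ {c L a} → (c , L) ∈ T → a ∈ L → M c ≡ true → M a ≡ true

model-selection⇔ : ∀ {M} t T → Model M (toAug (selection (t ∷ T))) ⇔
                   (Selects M (t ∷ T) × Propagates M (t ∷ T))
model-selection⇔ {M} (c , L) T = mk⇔
  (λ { (choice ∷ rules) →
         Any.map⁻ (headF-true⁻ M c _ (choice refl)) , to (Equivalence.to (model⇔all _) rules) })
  (λ (selects , propagates) →
     (λ _ → headF-true⁺ M c _ (Any.map⁺ selects))
     ∷ Equivalence.from (model⇔all _) (from propagates))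
  where open Equivalence (all-implications⇔ ((c , L) ∷ T))

record Separated (T : List (Atom × List Atom)) : Set where
  field
    functional : ∀ {c L L′} → (c , L) ∈ T → (c , L′) ∈ T → L ≡ L′
    selector∉  : ∀ {c L c′ L′} → (c , L) ∈ T → (c′ , L′) ∈ T → c ∉ L′

selected-⊆ : ∀ {M T c L} → Model M (toAug (selection T)) → (c , L) ∈ T → M c ≡ true →
             fromList (c ∷ L) ⊆ M
selected-⊆ {M} {t ∷ T} {c} {L} model c∈ Mc a a∈cL with fromList⇒∈ (c ∷ L) a a∈cL
... | here refl = Mc
... | there a∈L = proj₂ (Equivalence.to (model-selection⇔ t T) model) c∈ a∈L Mc

selected-model : ∀ {T c L} → Separated T → (c , L) ∈ T →
                 Model (fromList (c ∷ L)) (toAug (selection T))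
selected-model {t ∷ T} {c} {L} separated c∈ =
  Equivalence.from (model-selection⇔ t T)
    (Any.map (λ { refl → ∈⇒fromList {c ∷ L} (here refl) }) c∈ , propagates)
  where
  open Separated separated
  propagates : Propagates (fromList (c ∷ L)) (t ∷ T)
  propagates {c′} c′∈ a∈L′ c′∈cL with fromList⇒∈ (c ∷ L) c′ c′∈cL
  ... | here refl rewrite functional c′∈ c∈ = ∈⇒fromList (there a∈L′)
  ... | there c′∈L = ⊥-elim (selector∉ c′∈ c∈ c′∈L)

selected-minimal : ∀ {T c L} → Separated T → (c , L) ∈ T →
                   ∀ Y → Model Y (toAug (selection T)) → Y ⊆ fromList (c ∷ L) → fromList (c ∷ L) ⊆ Y
selected-minimal {t ∷ T} {c} {L} separated c∈ Y model Y⊆cL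
  with find (proj₁ (Equivalence.to (model-selection⇔ t T) model))
... | (c′ , L′) , c′∈ , Yc′ with fromList⇒∈ (c ∷ L) c′ (Y⊆cL c′ Yc′)
...   | here refl   = selected-⊆ model c∈ Yc′
...   | there c′∈L = ⊥-elim (Separated.selector∉ separated c′∈ c∈ c′∈L)

selected-minAnswerSet : ∀ {T c L} → Separated T → (c , L) ∈ T →
                        MinAnswerSet (selection T) (fromList (c ∷ L))
selected-minAnswerSet {t ∷ T} separated c∈ =
  minimalModel⇒answerSet (selection-positive t T) minimalModel , minimalModel
  where
  minimalModel = selected-model separated c∈ , selected-minimal separated c∈

minAnswerSet-selected : ∀ {T M} → Separated T → MinAnswerSet (selection T) M →
                        ∃₂ λ c L → (c , L) ∈ T × M ≐ fromList (c ∷ L)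
minAnswerSet-selected {[]} _ (answerSet , _) = ⊥-elim (selection[]-noAnswerSet answerSet)
minAnswerSet-selected {t ∷ T} separated (_ , model , minimal)
  with find (proj₁ (Equivalence.to (model-selection⇔ t T) model))
... | (c , L) , c∈ , Mc =
  c , L , c∈ , ⊆-antisym (minimal _ (selected-model separated c∈) cL⊆M) cL⊆M
  where
  cL⊆M = selected-⊆ model c∈ Mc

tagFrom : ℕ → List (List Atom) → List (Atom × List Atom)
tagFrom n [] = []
tagFrom n (L ∷ S) = (n , L) ∷ tagFrom (suc n) S

tagFrom-≥ : ∀ {n S c L} → (c , L) ∈ tagFrom n S → n ≤ c
tagFrom-≥ {S = _ ∷ _} (here refl) = ≤-refl
tagFrom-≥ {n} {_ ∷ _} (there c∈) = ≤-trans (n≤1+n n) (tagFrom-≥ c∈)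

tagFrom-∈ : ∀ {n S c L} → (c , L) ∈ tagFrom n S → L ∈ S
tagFrom-∈ {S = _ ∷ _} (here refl) = here refl
tagFrom-∈ {S = _ ∷ _} (there c∈) = there (tagFrom-∈ c∈)

∈-tagFrom : ∀ {n S L} → L ∈ S → ∃ λ c → (c , L) ∈ tagFrom n S
∈-tagFrom (here refl) = _ , here refl
∈-tagFrom (there L∈) = let c , c∈ = ∈-tagFrom L∈ in c , there c∈

tagFrom-functional : ∀ {n S c L L′} → (c , L) ∈ tagFrom n S → (c , L′) ∈ tagFrom n S → L ≡ L′
tagFrom-functional {S = _ ∷ _} (here refl) (here refl) = refl
tagFrom-functional {S = _ ∷ _} (here refl) (there c∈) = ⊥-elim (1+n≰n (tagFrom-≥ c∈))
tagFrom-functional {S = _ ∷ _} (there c∈) (here refl) = ⊥-elim (1+n≰n (tagFrom-≥ c∈))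
tagFrom-functional {S = _ ∷ _} (there c∈) (there c∈′) = tagFrom-functional c∈ c∈′

tagFrom-separated : ∀ {n S} → (∀ {L a} → L ∈ S → a ∈ L → a < n) → Separated (tagFrom n S)
tagFrom-separated bound = record
  { functional = tagFrom-functional
  ; selector∉  = λ c∈ c′∈ c∈L′ → <⇒≱ (bound (tagFrom-∈ c′∈) c∈L′) (tagFrom-≥ c∈)
  }

answerSets : AugProgram → List (List Atom)
answerSets P = filter (answerSet? P) (subsets (σ P))

answerSets-sound : ∀ P {L} → L ∈ answerSets P → AnswerSet P (fromList L) × L List.⊆ σ P
answerSets-sound P L∈ =
  let L∈subsets , answerSet = ∈-filter⁻ (answerSet? P) {xs = subsets (σ P)} L∈
  in answerSet , subsets-⊆ L∈subsets

answerSets-complete : ∀ P {X} → AnswerSet P X → ∃ λ L → L ∈ answerSets P × fromList L ≐ X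
answerSets-complete P {X} answerSet =
  L , ∈-filter⁺ (answerSet? P) (listWithin∈subsets (σ P) X) (answerSet-cong P (sym ∘ L≐X) answerSet)
    , L≐X
  where
  L = listWithin (σ P) X
  L≐X = fromList-listWithin (σ P) (answerSet⊆σ P answerSet)

fromList-∩σ : ∀ {c L} P → L List.⊆ σ P → c ∉ σ P → (fromList (c ∷ L) ∩σ P) ≐ fromList L
fromList-∩σ {c} {L} P L⊆σ c∉σ = ⊆-antisym ⊆L L⊆
  where
  ⊆L : (fromList (c ∷ L) ∩σ P) ⊆ fromList L
  ⊆L a a∈ with fromList⇒∈ (c ∷ L) a (∧-conicalˡ _ _ a∈)
  ... | here refl = ⊥-elim (c∉σ (fromList⇒∈ (σ P) a (∧-conicalʳ _ _ a∈)))
  ... | there a∈L = ∈⇒fromList a∈L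
  L⊆ : fromList L ⊆ (fromList (c ∷ L) ∩σ P)
  L⊆ a a∈ = let a∈L = fromList⇒∈ L a a∈ in cong₂ _∧_ (∈⇒fromList (there a∈L)) (∈⇒fromList (L⊆σ a∈L))

fresh : AugProgram → Atom
fresh P = suc (max 0 (σ P))

σ<fresh : ∀ P {a} → a ∈ σ P → a < fresh P
σ<fresh P a∈σ = s≤s (All.lookup (xs≤max 0 (σ P)) a∈σ)

taggedAnswerSets : AugProgram → List (Atom × List Atom)
taggedAnswerSets P = tagFrom (fresh P) (answerSets P)

translate : AugProgram → DisjProgram
translate P = selection (taggedAnswerSets P)

taggedAnswerSets-separated : ∀ P → Separated (taggedAnswerSets P)
taggedAnswerSets-separated P =
  tagFrom-separated λ L∈ a∈L → σ<fresh P (proj₂ (answerSets-sound P L∈) a∈L)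

taggedAnswerSets-∩σ : ∀ P {c L} → (c , L) ∈ taggedAnswerSets P →
                      (fromList (c ∷ L) ∩σ P) ≐ fromList L
taggedAnswerSets-∩σ P c∈ =
  fromList-∩σ P (proj₂ (answerSets-sound P (tagFrom-∈ c∈)))
                (λ c∈σ → <⇒≱ (σ<fresh P c∈σ) (tagFrom-≥ c∈))

corollary5p5 : Σ (AugProgram → DisjProgram) λ tr →
    ∀ (P : AugProgram) (X : AtomSet) →
      (AnswerSet P X → ∃ λ M′ → MinAnswerSet (tr P) M′ × (X ≐ (M′ ∩σ P)))
      × ((∃ λ M′ → MinAnswerSet (tr P) M′ × (X ≐ (M′ ∩σ P))) → AnswerSet P X)
corollary5p5 = translate , λ P X → complete P , sound P
  where
  complete : ∀ P {X} → AnswerSet P X → ∃ λ M′ → MinAnswerSet (translate P) M′ × (X ≐ (M′ ∩σ P))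
  complete P answerSet =
    let L , L∈ , L≐X = answerSets-complete P answerSet
        c , c∈ = ∈-tagFrom L∈
    in fromList (c ∷ L) , selected-minAnswerSet (taggedAnswerSets-separated P) c∈ ,
       λ a → sym (trans (taggedAnswerSets-∩σ P c∈ a) (L≐X a))

  sound : ∀ P {X} → (∃ λ M′ → MinAnswerSet (translate P) M′ × (X ≐ (M′ ∩σ P))) → AnswerSet P X
  sound P {X} (M′ , minAnswerSet , X≐M′∩σ) =
    let c , L , c∈ , M′≐cL = minAnswerSet-selected (taggedAnswerSets-separated P) minAnswerSet
        L≐X : fromList L ≐ X
        L≐X a = begin
          fromList L a                ≡⟨ sym (taggedAnswerSets-∩σ P c∈ a) ⟩
          (fromList (c ∷ L) ∩σ P) a  ≡⟨ cong (_∧ inσ P a) (sym (M′≐cL a)) ⟩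
          (M′ ∩σ P) a                 ≡⟨ sym (X≐M′∩σ a) ⟩
          X a                         ∎
    in answerSet-cong P L≐X (proj₁ (answerSets-sound P (tagFrom-∈ c∈)))
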